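{- Let $t$ be a $\lambda$-term. There is a $\beta_f$-normalizing derivation $d$ from $t$ if and only if there is a $\mathsf{vsub}$-normalizing derivation $e$ from $t$. Moreover, for such $d$ and $e$, $|d|\le |e|\le 2|d|$.
   Context: $\lambda$-terms: $t,u::= v\mid tu$, values $v::= x\mid \lambda x.t$, up to $\alpha$; $t\{x\leftarrow u\}$ capture-avoiding substitution. Evaluation contexts $E::=\langle\cdot\rangle\mid tE\mid Et$. Fireball calculus: fireballs $f::=\lambda x.t\mid i$, inert terms $i::= x f_1\dots f_n$ ($n\ge0$). $\to_{\beta_f}$ is the closure under evaluation contexts of $(\lambda x.t)(\lambda y.u)\mapsto t\{x\leftarrow \lambda y.u\}$ and $(\lambda x.t)i\mapsto t\{x\leftarrow i\}$ ($i$ inert). Value substitution calculus: vsub-terms $t,u::= v\mid tu\mid t[x\leftarrow u]$, vsub-values $v::=x\mid\lambda x.t$; $t[x\leftarrow u]$ binds $x$ in $t$. Evaluation contexts $E::=\langle\cdot\rangle\mid tE\mid Et\mid E[x\leftarrow u]\mid t[x\leftarrow E]$; substitution contexts $L::=\langle\cdot\rangle\mid L[x\leftarrow u]$. $\to_{\mathsf{vsub}}$ is the closure under evaluation contexts of $L\langle\lambda x.t\rangle u\mapsto L\langle t[x\leftarrow u]\rangle$ and $t[x\leftarrow L\langle v\rangle]\mapsto L\langle t\{x\leftarrow v\}\rangle$ ($v$ a vsub-value; variables bound by $L$ not free in $u$, resp. $t$). A derivation is $\mathsf r$-normalizing if it ends in an $\mathsf r$-normal term; $|d|$ is the length of $d$.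 -}

module Defs where

open import Data.Nat using (ℕ; zero; suc)
open import Data.Fin using (Fin; zero; suc)
open import Data.Product using (∃)
open import Relation.Nullary using (¬_)

data Deriv {A : Set} (R : A → A → Set) : A → A → Set where
  done : ∀ {a} → Deriv R a a
  step : ∀ {a b c} → R a b → Deriv R b c → Deriv R a c

len : ∀ {A : Set} {R : A → A → Set} {a b : A} → Deriv R a b → ℕ
len done       = 0
len (step _ d) = suc (len d)

Normal : ∀ {A : Set} → (A → A → Set) → A → Set
Normal R a = ¬ ∃ (λ b → R a b)

-- λ-terms, scoped de Bruijn (terms up to α); Tm n has free vars in Fin n

data Tm (n : ℕ) : Set where
  var : Fin n → Tm n
  lam : Tm (suc n) → Tm n
  app : Tm n → Tm n → Tm n

liftR : ∀ {n m} → (Fin n → Fin m) → Fin (suc n) → Fin (suc m)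
liftR ρ zero    = zero
liftR ρ (suc i) = suc (ρ i)

ren : ∀ {n m} → (Fin n → Fin m) → Tm n → Tm m
ren ρ (var x)   = var (ρ x)
ren ρ (lam t)   = lam (ren (liftR ρ) t)
ren ρ (app t u) = app (ren ρ t) (ren ρ u)

liftS : ∀ {n m} → (Fin n → Tm m) → Fin (suc n) → Tm (suc m)
liftS σ zero    = var zero
liftS σ (suc i) = ren suc (σ i)

sub : ∀ {n m} → (Fin n → Tm m) → Tm n → Tm m
sub σ (var x)   = σ x
sub σ (lam t)   = lam (sub (liftS σ) t)
sub σ (app t u) = app (sub σ t) (sub σ u)

-- t{x←u}, x the variable bound at index 0 (capture-avoiding)
single : ∀ {n} → Tm n → Fin (suc n) → Tm n
single u zero    = u
single u (suc i) = var i

_[0≔_] : ∀ {n} → Tm (suc n) → Tm n → Tm n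
t [0≔ u ] = sub (single u) t

mutual
  data Inert {n : ℕ} : Tm n → Set where
    ivar : ∀ x → Inert (var x)
    iapp : ∀ {i f} → Inert i → Fireball f → Inert (app i f)

  data Fireball {n : ℕ} : Tm n → Set where
    flam : ∀ t → Fireball (lam t)
    finert : ∀ {i} → Inert i → Fireball i

data _→βf_ {n : ℕ} : Tm n → Tm n → Set where
  βλ   : ∀ t u → app (lam t) (lam u) →βf (t [0≔ lam u ])
  βi   : ∀ t {i} → Inert i → app (lam t) i →βf (t [0≔ i ])
  appR : ∀ t {u u'} → u →βf u' → app t u →βf app t u'
  appL : ∀ {t t'} u → t →βf t' → app t u →βf app t' u

-- vsub-terms; es t u is t[x←u], binding x (index 0) in t
data VTm (n : ℕ) : Set where
  var : Fin n → VTm n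
  lam : VTm (suc n) → VTm n
  app : VTm n → VTm n → VTm n
  es  : VTm (suc n) → VTm n → VTm n

data IsValue {n : ℕ} : VTm n → Set where
  vvar : ∀ x → IsValue (var x)
  vlam : ∀ t → IsValue (lam t)

vren : ∀ {n m} → (Fin n → Fin m) → VTm n → VTm m
vren ρ (var x)   = var (ρ x)
vren ρ (lam t)   = lam (vren (liftR ρ) t)
vren ρ (app t u) = app (vren ρ t) (vren ρ u)
vren ρ (es t u)  = es (vren (liftR ρ) t) (vren ρ u)

vliftS : ∀ {n m} → (Fin n → VTm m) → Fin (suc n) → VTm (suc m)
vliftS σ zero    = var zero
vliftS σ (suc i) = vren suc (σ i)

vsubst : ∀ {n m} → (Fin n → VTm m) → VTm n → VTm m
vsubst σ (var x)   = σ x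
vsubst σ (lam t)   = lam (vsubst (vliftS σ) t)
vsubst σ (app t u) = app (vsubst σ t) (vsubst σ u)
vsubst σ (es t u)  = es (vsubst (vliftS σ) t) (vsubst σ u)

vsingle : ∀ {n} → VTm n → Fin (suc n) → VTm n
vsingle u zero    = u
vsingle u (suc i) = var i

-- meta-level (capture-avoiding) substitution t{x←v}
_v[0≔_] : ∀ {n} → VTm (suc n) → VTm n → VTm n
t v[0≔ u ] = vsubst (vsingle u) t

-- substitution contexts L ::= ⟨·⟩ | L[x←u].
-- SCtx n m : plugging a term with scope m yields a term with scope n.
data SCtx (n : ℕ) : ℕ → Set where
  hole : SCtx n n
  esub : ∀ {m} → SCtx (suc n) m → VTm n → SCtx n m

plug : ∀ {n m} → SCtx n m → VTm m → VTm n
plug hole       t = t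
plug (esub L u) t = es (plug L t) u

-- weakening of the outer scope past the variables bound by L
-- (this realises the side condition "variables bound by L not free in u")
wkL : ∀ {n m} → SCtx n m → Fin n → Fin m
wkL hole       i = i
wkL (esub L u) i = wkL L (suc i)

-- →vsub : closure under E ::= ⟨·⟩ | tE | Et | E[x←u] | t[x←E] of
--   L⟨λx.t⟩u ↦ L⟨t[x←u]⟩   and   t[x←L⟨v⟩] ↦ L⟨t{x←v}⟩
data _→vsub_ {n : ℕ} : VTm n → VTm n → Set where
  dB   : ∀ {m} (L : SCtx n m) t u →
         app (plug L (lam t)) u →vsub plug L (es t (vren (wkL L) u))
  lsv  : ∀ {m} (L : SCtx n m) t {v} → IsValue v →
         es t (plug L v) →vsub plug L ((vren (liftR (wkL L)) t) v[0≔ v ])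
  appR : ∀ t {u u'} → u →vsub u' → app t u →vsub app t u'
  appL : ∀ {t t'} u → t →vsub t' → app t u →vsub app t' u
  esL  : ∀ {t t'} u → t →vsub t' → es t u →vsub es t' u
  esR  : ∀ t {u u'} → u →vsub u' → es t u →vsub es t u'

ι : ∀ {n} → Tm n → VTm n
ι (var x)   = var x
ι (lam t)   = lam (ι t)
ι (app t u) = app (ι t) (ι u)

-- Read back through the unfolding map that executes every explicit substitution, a
-- vsub-term reached from a λ-term stands for a λ-term.  Along the reachable terms every
-- explicit substitution holds an inert non-answer, so a vsub-step can only fire where
-- the unfolded term has a βf-redex, and conversely a βf-step is simulated by one
-- multiplicative step (inert argument) or by a multiplicative step followed by one
-- substitution step (abstraction argument).  This gives |d| ≤ |e| ≤ 2|d| for the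
-- simulating derivation e together with transfer of normal forms.  Finally vsub has the
-- diamond property, so all its normalizing derivations from a term have the same length
-- and bound every other derivation; this extends the bound to every e and makes
-- vsub-normalization imply βf-normalization.
module Submission where

open import Defs
open import Data.Nat using (ℕ; zero; suc; _≤_; _*_; _+_; z≤n; s≤s)
open import Data.Nat.Properties using (≤-trans; n≤1+n; ≤-pred; ≤-refl; ≤-reflexive; +-identityʳ; +-suc; suc-injective; m≤m+n)
open import Data.Fin using (Fin; zero; suc)
open import Data.Product using (_×_; Σ; ∃; _,_)
open import Data.Sum using (_⊎_; inj₁; inj₂)
open import Data.Empty using (⊥; ⊥-elim)
open import Function.Bundles using (_⇔_; mk⇔)
open import Relation.Binary.PropositionalEquality
open ≡-Reasoning

liftR-cong : ∀ {n m} {ρ ρ' : Fin n → Fin m} → ρ ≗ ρ' → liftR ρ ≗ liftR ρ'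
liftR-cong e zero    = refl
liftR-cong e (suc i) = cong suc (e i)

liftR-∘ : ∀ {n m k} (ρ : Fin m → Fin k) (ρ' : Fin n → Fin m) →
  (λ i → liftR ρ (liftR ρ' i)) ≗ liftR (λ i → ρ (ρ' i))
liftR-∘ ρ ρ' zero    = refl
liftR-∘ ρ ρ' (suc i) = refl

ren-cong : ∀ {n m} {ρ ρ' : Fin n → Fin m} → ρ ≗ ρ' → ∀ t → ren ρ t ≡ ren ρ' t
ren-cong e (var x)   = cong var (e x)
ren-cong e (lam t)   = cong lam (ren-cong (liftR-cong e) t)
ren-cong e (app t u) = cong₂ app (ren-cong e t) (ren-cong e u)

liftS-cong : ∀ {n m} {σ σ' : Fin n → Tm m} → σ ≗ σ' → liftS σ ≗ liftS σ'
liftS-cong e zero    = refl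
liftS-cong e (suc i) = cong (ren suc) (e i)

sub-cong : ∀ {n m} {σ σ' : Fin n → Tm m} → σ ≗ σ' → ∀ t → sub σ t ≡ sub σ' t
sub-cong e (var x)   = e x
sub-cong e (lam t)   = cong lam (sub-cong (liftS-cong e) t)
sub-cong e (app t u) = cong₂ app (sub-cong e t) (sub-cong e u)

ren-ren : ∀ {n m k} (ρ : Fin m → Fin k) (ρ' : Fin n → Fin m) t →
  ren ρ (ren ρ' t) ≡ ren (λ i → ρ (ρ' i)) t
ren-ren ρ ρ' (var x)   = refl
ren-ren ρ ρ' (lam t)   = cong lam (trans (ren-ren (liftR ρ) (liftR ρ') t) (ren-cong (liftR-∘ ρ ρ') t))
ren-ren ρ ρ' (app t u) = cong₂ app (ren-ren ρ ρ' t) (ren-ren ρ ρ' u)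

liftS-liftR : ∀ {n m k} (σ : Fin m → Tm k) (ρ : Fin n → Fin m) →
  (λ i → liftS σ (liftR ρ i)) ≗ liftS (λ i → σ (ρ i))
liftS-liftR σ ρ zero    = refl
liftS-liftR σ ρ (suc i) = refl

sub-ren : ∀ {n m k} (σ : Fin m → Tm k) (ρ : Fin n → Fin m) t →
  sub σ (ren ρ t) ≡ sub (λ i → σ (ρ i)) t
sub-ren σ ρ (var x)   = refl
sub-ren σ ρ (lam t)   = cong lam (trans (sub-ren (liftS σ) (liftR ρ) t) (sub-cong (liftS-liftR σ ρ) t))
sub-ren σ ρ (app t u) = cong₂ app (sub-ren σ ρ t) (sub-ren σ ρ u)

ren-liftS : ∀ {n m k} (ρ : Fin m → Fin k) (σ : Fin n → Tm m) →
  (λ i → ren (liftR ρ) (liftS σ i)) ≗ liftS (λ i → ren ρ (σ i))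
ren-liftS ρ σ zero    = refl
ren-liftS ρ σ (suc i) = trans (ren-ren (liftR ρ) suc (σ i)) (sym (ren-ren suc ρ (σ i)))

ren-sub : ∀ {n m k} (ρ : Fin m → Fin k) (σ : Fin n → Tm m) t →
  ren ρ (sub σ t) ≡ sub (λ i → ren ρ (σ i)) t
ren-sub ρ σ (var x)   = refl
ren-sub ρ σ (lam t)   = cong lam (trans (ren-sub (liftR ρ) (liftS σ) t) (sub-cong (ren-liftS ρ σ) t))
ren-sub ρ σ (app t u) = cong₂ app (ren-sub ρ σ t) (ren-sub ρ σ u)

sub-var : ∀ {n} (t : Tm n) → sub var t ≡ t
sub-var (var x)   = refl
sub-var (lam t)   = cong lam (trans (sub-cong liftS-var t) (sub-var t))
  where
  liftS-var : ∀ {n} → liftS (var {n}) ≗ var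
  liftS-var zero    = refl
  liftS-var (suc i) = refl
sub-var (app t u) = cong₂ app (sub-var t) (sub-var u)

vren-cong : ∀ {n m} {ρ ρ' : Fin n → Fin m} → ρ ≗ ρ' → ∀ t → vren ρ t ≡ vren ρ' t
vren-cong e (var x)   = cong var (e x)
vren-cong e (lam t)   = cong lam (vren-cong (liftR-cong e) t)
vren-cong e (app t u) = cong₂ app (vren-cong e t) (vren-cong e u)
vren-cong e (es t u)  = cong₂ es (vren-cong (liftR-cong e) t) (vren-cong e u)

vliftS-cong : ∀ {n m} {σ σ' : Fin n → VTm m} → σ ≗ σ' → vliftS σ ≗ vliftS σ'
vliftS-cong e zero    = refl
vliftS-cong e (suc i) = cong (vren suc) (e i)

vsubst-cong : ∀ {n m} {σ σ' : Fin n → VTm m} → σ ≗ σ' → ∀ t → vsubst σ t ≡ vsubst σ' t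
vsubst-cong e (var x)   = e x
vsubst-cong e (lam t)   = cong lam (vsubst-cong (vliftS-cong e) t)
vsubst-cong e (app t u) = cong₂ app (vsubst-cong e t) (vsubst-cong e u)
vsubst-cong e (es t u)  = cong₂ es (vsubst-cong (vliftS-cong e) t) (vsubst-cong e u)

vren-vren : ∀ {n m k} (ρ : Fin m → Fin k) (ρ' : Fin n → Fin m) t →
  vren ρ (vren ρ' t) ≡ vren (λ i → ρ (ρ' i)) t
vren-vren ρ ρ' (var x)   = refl
vren-vren ρ ρ' (lam t)   = cong lam (trans (vren-vren (liftR ρ) (liftR ρ') t) (vren-cong (liftR-∘ ρ ρ') t))
vren-vren ρ ρ' (app t u) = cong₂ app (vren-vren ρ ρ' t) (vren-vren ρ ρ' u)
vren-vren ρ ρ' (es t u)  =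
  cong₂ es (trans (vren-vren (liftR ρ) (liftR ρ') t) (vren-cong (liftR-∘ ρ ρ') t)) (vren-vren ρ ρ' u)

vliftS-liftR : ∀ {n m k} (σ : Fin m → VTm k) (ρ : Fin n → Fin m) →
  (λ i → vliftS σ (liftR ρ i)) ≗ vliftS (λ i → σ (ρ i))
vliftS-liftR σ ρ zero    = refl
vliftS-liftR σ ρ (suc i) = refl

vsubst-vren : ∀ {n m k} (σ : Fin m → VTm k) (ρ : Fin n → Fin m) t →
  vsubst σ (vren ρ t) ≡ vsubst (λ i → σ (ρ i)) t
vsubst-vren σ ρ (var x)   = refl
vsubst-vren σ ρ (lam t)   =
  cong lam (trans (vsubst-vren (vliftS σ) (liftR ρ) t) (vsubst-cong (vliftS-liftR σ ρ) t))
vsubst-vren σ ρ (app t u) = cong₂ app (vsubst-vren σ ρ t) (vsubst-vren σ ρ u)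
vsubst-vren σ ρ (es t u)  =
  cong₂ es (trans (vsubst-vren (vliftS σ) (liftR ρ) t) (vsubst-cong (vliftS-liftR σ ρ) t)) (vsubst-vren σ ρ u)

vren-vliftS : ∀ {n m k} (ρ : Fin m → Fin k) (σ : Fin n → VTm m) →
  (λ i → vren (liftR ρ) (vliftS σ i)) ≗ vliftS (λ i → vren ρ (σ i))
vren-vliftS ρ σ zero    = refl
vren-vliftS ρ σ (suc i) = trans (vren-vren (liftR ρ) suc (σ i)) (sym (vren-vren suc ρ (σ i)))

vren-vsubst : ∀ {n m k} (ρ : Fin m → Fin k) (σ : Fin n → VTm m) t →
  vren ρ (vsubst σ t) ≡ vsubst (λ i → vren ρ (σ i)) t
vren-vsubst ρ σ (var x)   = refl
vren-vsubst ρ σ (lam t)   =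
  cong lam (trans (vren-vsubst (liftR ρ) (vliftS σ) t) (vsubst-cong (vren-vliftS ρ σ) t))
vren-vsubst ρ σ (app t u) = cong₂ app (vren-vsubst ρ σ t) (vren-vsubst ρ σ u)
vren-vsubst ρ σ (es t u)  =
  cong₂ es (trans (vren-vsubst (liftR ρ) (vliftS σ) t) (vsubst-cong (vren-vliftS ρ σ) t)) (vren-vsubst ρ σ u)

vsubst-vliftS : ∀ {n m k} (σ : Fin m → VTm k) (τ : Fin n → VTm m) →
  (λ i → vsubst (vliftS σ) (vliftS τ i)) ≗ vliftS (λ i → vsubst σ (τ i))
vsubst-vliftS σ τ zero    = refl
vsubst-vliftS σ τ (suc i) = trans (vsubst-vren (vliftS σ) suc (τ i)) (sym (vren-vsubst suc σ (τ i)))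

vsubst-vsubst : ∀ {n m k} (σ : Fin m → VTm k) (τ : Fin n → VTm m) t →
  vsubst σ (vsubst τ t) ≡ vsubst (λ i → vsubst σ (τ i)) t
vsubst-vsubst σ τ (var x)   = refl
vsubst-vsubst σ τ (lam t)   =
  cong lam (trans (vsubst-vsubst (vliftS σ) (vliftS τ) t) (vsubst-cong (vsubst-vliftS σ τ) t))
vsubst-vsubst σ τ (app t u) = cong₂ app (vsubst-vsubst σ τ t) (vsubst-vsubst σ τ u)
vsubst-vsubst σ τ (es t u)  =
  cong₂ es (trans (vsubst-vsubst (vliftS σ) (vliftS τ) t) (vsubst-cong (vsubst-vliftS σ τ) t)) (vsubst-vsubst σ τ u)

vliftS-var : ∀ {n} → vliftS (var {n}) ≗ var
vliftS-var zero    = refl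
vliftS-var (suc i) = refl

vsubst-var : ∀ {n} (t : VTm n) → vsubst var t ≡ t
vsubst-var (var x)   = refl
vsubst-var (lam t)   = cong lam (trans (vsubst-cong vliftS-var t) (vsubst-var t))
vsubst-var (app t u) = cong₂ app (vsubst-var t) (vsubst-var u)
vsubst-var (es t u)  = cong₂ es (trans (vsubst-cong vliftS-var t) (vsubst-var t)) (vsubst-var u)

var-liftR : ∀ {n m} (ρ : Fin n → Fin m) → (λ i → var (liftR ρ i)) ≗ vliftS (λ i → var (ρ i))
var-liftR ρ zero    = refl
var-liftR ρ (suc i) = refl

vren≡vsubst : ∀ {n m} (ρ : Fin n → Fin m) t → vren ρ t ≡ vsubst (λ i → var (ρ i)) t
vren≡vsubst ρ (var x)   = refl
vren≡vsubst ρ (lam t)   = cong lam (trans (vren≡vsubst (liftR ρ) t) (vsubst-cong (var-liftR ρ) t))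
vren≡vsubst ρ (app t u) = cong₂ app (vren≡vsubst ρ t) (vren≡vsubst ρ u)
vren≡vsubst ρ (es t u)  = cong₂ es (trans (vren≡vsubst (liftR ρ) t) (vsubst-cong (var-liftR ρ) t)) (vren≡vsubst ρ u)

vren-id : ∀ {n} (t : VTm n) → vren (λ i → i) t ≡ t
vren-id t = trans (vren≡vsubst (λ i → i) t) (vsubst-var t)

-- unfold σ t turns every t'[x←u] into t'{x←u}; σ is the λ-term standing for each free variable.
extend : ∀ {n k} → (Fin n → Tm k) → Tm k → Fin (suc n) → Tm k
extend σ u zero    = u
extend σ u (suc i) = σ i

unfold : ∀ {n k} → (Fin n → Tm k) → VTm n → Tm k
unfold σ (var x)   = σ x
unfold σ (lam t)   = lam (unfold (liftS σ) t)
unfold σ (app t u) = app (unfold σ t) (unfold σ u)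
unfold σ (es t u)  = unfold (extend σ (unfold σ u)) t

extend-cong : ∀ {n k} {σ σ' : Fin n → Tm k} {u u'} → σ ≗ σ' → u ≡ u' → extend σ u ≗ extend σ' u'
extend-cong e e' zero    = e'
extend-cong e e' (suc i) = e i

unfold-cong : ∀ {n k} {σ σ' : Fin n → Tm k} → σ ≗ σ' → ∀ t → unfold σ t ≡ unfold σ' t
unfold-cong e (var x)   = e x
unfold-cong e (lam t)   = cong lam (unfold-cong (liftS-cong e) t)
unfold-cong e (app t u) = cong₂ app (unfold-cong e t) (unfold-cong e u)
unfold-cong e (es t u)  = unfold-cong (extend-cong e (unfold-cong e u)) t

unfold-vren : ∀ {n m k} (τ : Fin m → Tm k) (ρ : Fin n → Fin m) t →
  unfold τ (vren ρ t) ≡ unfold (λ i → τ (ρ i)) t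
unfold-vren τ ρ (var x)   = refl
unfold-vren τ ρ (lam t)   =
  cong lam (trans (unfold-vren (liftS τ) (liftR ρ) t) (unfold-cong (liftS-liftR τ ρ) t))
unfold-vren τ ρ (app t u) = cong₂ app (unfold-vren τ ρ t) (unfold-vren τ ρ u)
unfold-vren τ ρ (es t u)  = trans (unfold-vren _ (liftR ρ) t) (unfold-cong extend-liftR t)
  where
  extend-liftR : (λ i → extend τ (unfold τ (vren ρ u)) (liftR ρ i)) ≗ extend (λ i → τ (ρ i)) (unfold (λ i → τ (ρ i)) u)
  extend-liftR zero    = unfold-vren τ ρ u
  extend-liftR (suc i) = refl

ren-unfold : ∀ {n m k} (ρ : Fin m → Fin k) (τ : Fin n → Tm m) t →
  ren ρ (unfold τ t) ≡ unfold (λ i → ren ρ (τ i)) t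
ren-unfold ρ τ (var x)   = refl
ren-unfold ρ τ (lam t)   =
  cong lam (trans (ren-unfold (liftR ρ) (liftS τ) t) (unfold-cong (ren-liftS ρ τ) t))
ren-unfold ρ τ (app t u) = cong₂ app (ren-unfold ρ τ t) (ren-unfold ρ τ u)
ren-unfold ρ τ (es t u)  = trans (ren-unfold ρ _ t) (unfold-cong ren-extend t)
  where
  ren-extend : (λ i → ren ρ (extend τ (unfold τ u) i)) ≗ extend (λ i → ren ρ (τ i)) (unfold (λ i → ren ρ (τ i)) u)
  ren-extend zero    = ren-unfold ρ τ u
  ren-extend (suc i) = refl

sub-liftS : ∀ {n m k} (σ : Fin m → Tm k) (τ : Fin n → Tm m) →
  (λ i → sub (liftS σ) (liftS τ i)) ≗ liftS (λ i → sub σ (τ i))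
sub-liftS σ τ zero    = refl
sub-liftS σ τ (suc i) = trans (sub-ren (liftS σ) suc (τ i)) (sym (ren-sub suc σ (τ i)))

sub-unfold : ∀ {n m k} (σ : Fin m → Tm k) (τ : Fin n → Tm m) t →
  sub σ (unfold τ t) ≡ unfold (λ i → sub σ (τ i)) t
sub-unfold σ τ (var x)   = refl
sub-unfold σ τ (lam t)   =
  cong lam (trans (sub-unfold (liftS σ) (liftS τ) t) (unfold-cong (sub-liftS σ τ) t))
sub-unfold σ τ (app t u) = cong₂ app (sub-unfold σ τ t) (sub-unfold σ τ u)
sub-unfold σ τ (es t u)  = trans (sub-unfold σ _ t) (unfold-cong sub-extend t)
  where
  sub-extend : (λ i → sub σ (extend τ (unfold τ u) i)) ≗ extend (λ i → sub σ (τ i)) (unfold (λ i → sub σ (τ i)) u)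
  sub-extend zero    = sub-unfold σ τ u
  sub-extend (suc i) = refl

unfold-vliftS : ∀ {n m k} (τ : Fin m → Tm k) (σ : Fin n → VTm m) →
  (λ i → unfold (liftS τ) (vliftS σ i)) ≗ liftS (λ i → unfold τ (σ i))
unfold-vliftS τ σ zero    = refl
unfold-vliftS τ σ (suc i) = trans (unfold-vren (liftS τ) suc (σ i)) (sym (ren-unfold suc τ (σ i)))

unfold-vsubst : ∀ {n m k} (τ : Fin m → Tm k) (σ : Fin n → VTm m) t →
  unfold τ (vsubst σ t) ≡ unfold (λ i → unfold τ (σ i)) t
unfold-vsubst τ σ (var x)   = refl
unfold-vsubst τ σ (lam t)   =
  cong lam (trans (unfold-vsubst (liftS τ) (vliftS σ) t) (unfold-cong (unfold-vliftS τ σ) t))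
unfold-vsubst τ σ (app t u) = cong₂ app (unfold-vsubst τ σ t) (unfold-vsubst τ σ u)
unfold-vsubst τ σ (es t u)  = trans (unfold-vsubst _ (vliftS σ) t) (unfold-cong unfold-extend t)
  where
  unfold-extend : (λ i → unfold (extend τ (unfold τ (vsubst σ u))) (vliftS σ i))
                ≗ extend (λ i → unfold τ (σ i)) (unfold (λ i → unfold τ (σ i)) u)
  unfold-extend zero    = unfold-vsubst τ σ u
  unfold-extend (suc i) = unfold-vren _ suc (σ i)

unfold-ι : ∀ {n k} (τ : Fin n → Tm k) t → unfold τ (ι t) ≡ sub τ t
unfold-ι τ (var x)   = refl
unfold-ι τ (lam t)   = cong lam (unfold-ι (liftS τ) t)
unfold-ι τ (app t u) = cong₂ app (unfold-ι τ t) (unfold-ι τ u)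

vren-ι : ∀ {n m} (ρ : Fin n → Fin m) t → vren ρ (ι t) ≡ ι (ren ρ t)
vren-ι ρ (var x)   = refl
vren-ι ρ (lam t)   = cong lam (vren-ι (liftR ρ) t)
vren-ι ρ (app t u) = cong₂ app (vren-ι ρ t) (vren-ι ρ u)

vsubst-ι : ∀ {n m} (τ : Fin n → Tm m) t → vsubst (λ i → ι (τ i)) (ι t) ≡ ι (sub τ t)
vsubst-ι τ (var x)   = refl
vsubst-ι τ (lam t)   = cong lam (trans (vsubst-cong vliftS-ι (ι t)) (vsubst-ι (liftS τ) t))
  where
  vliftS-ι : vliftS (λ i → ι (τ i)) ≗ (λ i → ι (liftS τ i))
  vliftS-ι zero    = refl
  vliftS-ι (suc i) = vren-ι suc (τ i)
vsubst-ι τ (app t u) = cong₂ app (vsubst-ι τ t) (vsubst-ι τ u)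

unfoldCtx : ∀ {n m k} → (Fin n → Tm k) → SCtx n m → Fin m → Tm k
unfoldCtx σ hole       = σ
unfoldCtx σ (esub L u) = unfoldCtx (extend σ (unfold σ u)) L

unfold-plug : ∀ {n m k} (σ : Fin n → Tm k) (L : SCtx n m) t → unfold σ (plug L t) ≡ unfold (unfoldCtx σ L) t
unfold-plug σ hole       t = refl
unfold-plug σ (esub L u) t = unfold-plug (extend σ (unfold σ u)) L t

unfoldCtx-wkL : ∀ {n m k} (σ : Fin n → Tm k) (L : SCtx n m) i → unfoldCtx σ L (wkL L i) ≡ σ i
unfoldCtx-wkL σ hole       i = refl
unfoldCtx-wkL σ (esub L u) i = unfoldCtx-wkL (extend σ (unfold σ u)) L (suc i)

ValueSubst : ∀ {n m} → (Fin n → VTm m) → Set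
ValueSubst σ = ∀ i → IsValue (σ i)

vren-value : ∀ {n m} (ρ : Fin n → Fin m) {v} → IsValue v → IsValue (vren ρ v)
vren-value ρ (vvar x) = vvar (ρ x)
vren-value ρ (vlam t) = vlam _

vsubst-value : ∀ {n m} {σ : Fin n → VTm m} → ValueSubst σ → ∀ {v} → IsValue v → IsValue (vsubst σ v)
vsubst-value vσ (vvar x) = vσ x
vsubst-value vσ (vlam t) = vlam _

vliftS-value : ∀ {n m} {σ : Fin n → VTm m} → ValueSubst σ → ValueSubst (vliftS σ)
vliftS-value vσ zero    = vvar zero
vliftS-value vσ (suc i) = vren-value suc (vσ i)

vsingle-value : ∀ {n} {v : VTm n} → IsValue v → ValueSubst (vsingle v)
vsingle-value iv zero    = iv
vsingle-value iv (suc i) = vvar i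

-- Substituting σ into L⟨t⟩ yields L'⟨t'⟩ where t' is t under the substitution σ lifted past the binders of L.
record CtxSubst (n' m : ℕ) : Set where
  field
    {scope} : ℕ
    ctx     : SCtx n' scope
    inner   : Fin m → VTm scope
open CtxSubst

pushSubst : ∀ {n n' m} → (Fin n → VTm n') → SCtx n m → CtxSubst n' m
pushSubst σ hole       = record { ctx = hole ; inner = σ }
pushSubst σ (esub L u) = record { ctx = esub (ctx (pushSubst (vliftS σ) L)) (vsubst σ u)
                                ; inner = inner (pushSubst (vliftS σ) L) }

vsubst-plug : ∀ {n n' m} (σ : Fin n → VTm n') (L : SCtx n m) t →
  vsubst σ (plug L t) ≡ plug (ctx (pushSubst σ L)) (vsubst (inner (pushSubst σ L)) t)
vsubst-plug σ hole       t = refl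
vsubst-plug σ (esub L u) t = cong₂ es (vsubst-plug (vliftS σ) L t) refl

inner-wkL : ∀ {n n' m} (σ : Fin n → VTm n') (L : SCtx n m) i →
  inner (pushSubst σ L) (wkL L i) ≡ vren (wkL (ctx (pushSubst σ L))) (σ i)
inner-wkL σ hole       i = sym (vren-id (σ i))
inner-wkL σ (esub L u) i = trans (inner-wkL (vliftS σ) L (suc i)) (vren-vren _ suc (σ i))

inner-value : ∀ {n n' m} {σ : Fin n → VTm n'} → ValueSubst σ → (L : SCtx n m) → ValueSubst (inner (pushSubst σ L))
inner-value vσ hole       = vσ
inner-value vσ (esub L u) = inner-value (vliftS-value vσ) L

plug-→vsub : ∀ {n m} (L : SCtx n m) {t t'} → t →vsub t' → plug L t →vsub plug L t'
plug-→vsub hole       s = s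
plug-→vsub (esub L u) s = esL u (plug-→vsub L s)

vsubst-inner-wkL : ∀ {n n' m} (σ : Fin n → VTm n') (L : SCtx n m) u →
  vsubst (inner (pushSubst σ L)) (vren (wkL L) u) ≡ vren (wkL (ctx (pushSubst σ L))) (vsubst σ u)
vsubst-inner-wkL σ L u = begin
  vsubst f (vren (wkL L) u)            ≡⟨ vsubst-vren f (wkL L) u ⟩
  vsubst (λ i → f (wkL L i)) u         ≡⟨ vsubst-cong (inner-wkL σ L) u ⟩
  vsubst (λ i → vren (wkL L') (σ i)) u ≡⟨ vren-vsubst (wkL L') σ u ⟨
  vren (wkL L') (vsubst σ u)           ∎
  where
  L' = ctx (pushSubst σ L)
  f  = inner (pushSubst σ L)

vsubst-lsv-contractum : ∀ {n n' m} (σ : Fin n → VTm n') (L : SCtx n m) t v →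
  let L' = ctx (pushSubst σ L); f = inner (pushSubst σ L) in
  vsubst f ((vren (liftR (wkL L)) t) v[0≔ v ]) ≡ (vren (liftR (wkL L')) (vsubst (vliftS σ) t)) v[0≔ vsubst f v ]
vsubst-lsv-contractum σ L t v = begin
  vsubst f (vsubst (vsingle v) (vren (liftR w) t))  ≡⟨ cong (vsubst f) (vsubst-vren (vsingle v) (liftR w) t) ⟩
  vsubst f (vsubst (λ i → vsingle v (liftR w i)) t) ≡⟨ vsubst-vsubst f _ t ⟩
  vsubst (λ i → vsubst f (vsingle v (liftR w i))) t ≡⟨ vsubst-cong agree t ⟩
  vsubst (λ i → vsubst σ↑ (vliftS σ i)) t           ≡⟨ vsubst-vsubst σ↑ (vliftS σ) t ⟨
  vsubst σ↑ (vsubst (vliftS σ) t)                   ≡⟨ vsubst-vren (vsingle (vsubst f v)) (liftR w') (vsubst (vliftS σ) t) ⟨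
  vsubst (vsingle (vsubst f v)) (vren (liftR w') (vsubst (vliftS σ) t)) ∎
  where
  f  = inner (pushSubst σ L)
  w  = wkL L
  w' = wkL (ctx (pushSubst σ L))
  σ↑ = λ j → vsingle (vsubst f v) (liftR w' j)
  agree : (λ i → vsubst f (vsingle v (liftR w i))) ≗ (λ i → vsubst σ↑ (vliftS σ i))
  agree zero    = refl
  agree (suc i) = trans (inner-wkL σ L i) (trans (vren≡vsubst w' (σ i)) (sym (vsubst-vren _ suc (σ i))))

vsubst-→vsub : ∀ {n m} {σ : Fin n → VTm m} → ValueSubst σ → ∀ {t t'} → t →vsub t' → vsubst σ t →vsub vsubst σ t'
vsubst-→vsub {σ = σ} vσ (dB L t u) =
  subst₂ _→vsub_ (cong₂ app (sym (vsubst-plug σ L (lam t))) refl)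
    (sym (trans (vsubst-plug σ L _) (cong (λ w → plug L' (es (vsubst (vliftS f) t) w)) (vsubst-inner-wkL σ L u))))
    (dB L' (vsubst (vliftS f) t) (vsubst σ u))
  where
  L' = ctx (pushSubst σ L)
  f  = inner (pushSubst σ L)
vsubst-→vsub {σ = σ} vσ (lsv L t {v} iv) =
  subst₂ _→vsub_ (cong (es _) (sym (vsubst-plug σ L v)))
    (sym (trans (vsubst-plug σ L _) (cong (plug (ctx (pushSubst σ L))) (vsubst-lsv-contractum σ L t v))))
    (lsv (ctx (pushSubst σ L)) (vsubst (vliftS σ) t) (vsubst-value (inner-value vσ L) iv))
vsubst-→vsub vσ (appR t s) = appR _ (vsubst-→vsub vσ s)
vsubst-→vsub vσ (appL u s) = appL _ (vsubst-→vsub vσ s)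
vsubst-→vsub vσ (esL u s)  = esL _ (vsubst-→vsub (vliftS-value vσ) s)
vsubst-→vsub vσ (esR t s)  = esR _ (vsubst-→vsub vσ s)

vren-→vsub : ∀ {n m} (ρ : Fin n → Fin m) {t t'} → t →vsub t' → vren ρ t →vsub vren ρ t'
vren-→vsub ρ {t} {t'} s =
  subst₂ _→vsub_ (sym (vren≡vsubst ρ t)) (sym (vren≡vsubst ρ t')) (vsubst-→vsub (λ i → vvar (ρ i)) s)

-- The diamond property of →vsub

_++ᶜ_ : ∀ {n m k} → SCtx n m → SCtx m k → SCtx n k
hole       ++ᶜ L₂ = L₂
esub L₁ u  ++ᶜ L₂ = esub (L₁ ++ᶜ L₂) u

plug-++ᶜ : ∀ {n m k} (L₁ : SCtx n m) (L₂ : SCtx m k) t → plug (L₁ ++ᶜ L₂) t ≡ plug L₁ (plug L₂ t)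
plug-++ᶜ hole        L₂ t = refl
plug-++ᶜ (esub L₁ u) L₂ t = cong₂ es (plug-++ᶜ L₁ L₂ t) refl

wkL-++ᶜ : ∀ {n m k} (L₁ : SCtx n m) (L₂ : SCtx m k) i → wkL (L₁ ++ᶜ L₂) i ≡ wkL L₂ (wkL L₁ i)
wkL-++ᶜ hole        L₂ i = refl
wkL-++ᶜ (esub L₁ u) L₂ i = wkL-++ᶜ L₁ L₂ (suc i)

-- A step that is not inside the plugged term acts on it uniformly, by a value substitution
-- that fixes the variables bound outside L.
data PlugStep {n m} (L : SCtx n m) (t : VTm m) (r : VTm n) : Set where
  inside  : ∀ {t'} → t →vsub t' → r ≡ plug L t' → PlugStep L t r
  outside : ∀ {m'} (L' : SCtx n m') (f : Fin m → VTm m') → ValueSubst f →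
            r ≡ plug L' (vsubst f t) →
            (∀ t' → plug L t' →vsub plug L' (vsubst f t')) →
            (∀ i → f (wkL L i) ≡ var (wkL L' i)) → PlugStep L t r

plugStep : ∀ {n m} (L : SCtx n m) t {r} → plug L t →vsub r → PlugStep L t r
plugStep hole t s = inside s refl
plugStep (esub L u) t (esL .u s) with plugStep L t s
... | inside s' eq                  = inside s' (cong₂ es eq refl)
... | outside L' f vf eq uniform wk =
  outside (esub L' u) f vf (cong₂ es eq refl) (λ t' → esL u (uniform t')) (λ i → wk (suc i))
plugStep (esub L u) t (esR .(plug L t) {u' = u'} s) =
  outside (esub L u') var vvar (cong (λ w → es (plug L w) u') (sym (vsubst-var t)))
    (λ t' → subst (es (plug L t') u →vsub_) (cong (λ w → es (plug L w) u') (sym (vsubst-var t'))) (esR _ s))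
    (λ i → refl)
plugStep (esub L _) t (lsv L₂ _ {v} iv) =
  outside (L₂ ++ᶜ L₀) f (inner-value σ₀-value L) (fired t)
    (λ t' → subst (es (plug L t') (plug L₂ v) →vsub_) (fired t') (lsv L₂ (plug L t') iv)) wk
  where
  σ₀ = λ i → vsingle v (liftR (wkL L₂) i)
  σ₀-value : ValueSubst σ₀
  σ₀-value zero    = iv
  σ₀-value (suc i) = vvar _
  L₀ = ctx (pushSubst σ₀ L)
  f  = inner (pushSubst σ₀ L)
  fired : ∀ t' → plug L₂ ((vren (liftR (wkL L₂)) (plug L t')) v[0≔ v ]) ≡ plug (L₂ ++ᶜ L₀) (vsubst f t')
  fired t' = begin
    plug L₂ (vsubst (vsingle v) (vren (liftR (wkL L₂)) (plug L t'))) ≡⟨ cong (plug L₂) (vsubst-vren (vsingle v) _ (plug L t')) ⟩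
    plug L₂ (vsubst σ₀ (plug L t'))                                   ≡⟨ cong (plug L₂) (vsubst-plug σ₀ L t') ⟩
    plug L₂ (plug L₀ (vsubst f t'))                                   ≡⟨ plug-++ᶜ L₂ L₀ _ ⟨
    plug (L₂ ++ᶜ L₀) (vsubst f t')                                    ∎
  wk : ∀ i → f (wkL L (suc i)) ≡ var (wkL (L₂ ++ᶜ L₀) i)
  wk i = trans (inner-wkL σ₀ L (suc i)) (cong var (sym (wkL-++ᶜ L₂ L₀ i)))

app-injective : ∀ {n} {a b c d : VTm n} → app a c ≡ app b d → a ≡ b × c ≡ d
app-injective refl = refl , refl

es-injective : ∀ {n} {a b : VTm (suc n)} {c d : VTm n} → es a c ≡ es b d → a ≡ b × c ≡ d
es-injective refl = refl , refl

plug-value-injective : ∀ {n m m'} (L : SCtx n m) (L' : SCtx n m') {v v'} → IsValue v → IsValue v' →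
  plug L v ≡ plug L' v' → _≡_ {A = Σ ℕ (λ k → SCtx n k × VTm k)} (m , L , v) (m' , L' , v')
plug-value-injective hole       hole          _        _        refl = refl
plug-value-injective hole       (esub L' u)   (vvar x) _        ()
plug-value-injective hole       (esub L' u)   (vlam t) _        ()
plug-value-injective (esub L u) hole          _        (vvar x) ()
plug-value-injective (esub L u) hole          _        (vlam t) ()
plug-value-injective (esub L u) (esub L' u') iv       iv'      eq
  with es-injective eq
... | eqL , refl with plug-value-injective L L' iv iv' eqL
...   | refl = refl

value-normal : ∀ {n} {v : VTm n} → IsValue v → Normal _→vsub_ v
value-normal (vvar x) (_ , ())
value-normal (vlam t) (_ , ())

Joinable : ∀ {A : Set} → (A → A → Set) → A → A → Set
Joinable R b c = b ≡ c ⊎ ∃ λ d → R b d × R c d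

Joinable-sym : ∀ {A : Set} {R : A → A → Set} {b c} → Joinable R b c → Joinable R c b
Joinable-sym (inj₁ eq)          = inj₁ (sym eq)
Joinable-sym (inj₂ (d , p , q)) = inj₂ (d , q , p)

Joinable-map : ∀ {n m} {b c : VTm n} (F : VTm n → VTm m) →
  (∀ {x y} → x →vsub y → F x →vsub F y) → Joinable _→vsub_ b c → Joinable _→vsub_ (F b) (F c)
Joinable-map F F-step (inj₁ eq)          = inj₁ (cong F eq)
Joinable-map F F-step (inj₂ (d , p , q)) = inj₂ (F d , F-step p , F-step q)

dB-diamond : ∀ {n m} (L : SCtx n m) t u {a c} → a →vsub c → a ≡ app (plug L (lam t)) u →
  Joinable _→vsub_ (plug L (es t (vren (wkL L) u))) c
dB-diamond L t u (dB L' t' u') eq with app-injective eq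
... | eqF , refl with plug-value-injective L' L (vlam t') (vlam t) eqF
...   | refl = inj₁ refl
dB-diamond L t u (appR _ s) refl = inj₂ (_ , plug-→vsub L (esR t (vren-→vsub (wkL L) s)) , dB L t _)
dB-diamond L t u (appL .u s) refl with plugStep L (lam t) s
... | inside () _
... | outside L' f vf eq uniform wk =
  inj₂ (plug L' (es (vsubst (vliftS f) t) (vren (wkL L') u)) ,
        subst₂ _→vsub_ refl (cong (λ w → plug L' (es (vsubst (vliftS f) t) w)) f-fixes-u) (uniform _) ,
        subst₂ _→vsub_ (sym (cong (λ a → app a u) eq)) refl (dB L' _ u))
  where
  f-fixes-u : vsubst f (vren (wkL L) u) ≡ vren (wkL L') u
  f-fixes-u = begin
    vsubst f (vren (wkL L) u)              ≡⟨ vsubst-vren f (wkL L) u ⟩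
    vsubst (λ i → f (wkL L i)) u           ≡⟨ vsubst-cong wk u ⟩
    vsubst (λ i → var (wkL L' i)) u        ≡⟨ vren≡vsubst (wkL L') u ⟨
    vren (wkL L') u                        ∎

lsv-diamond : ∀ {n m} (L : SCtx n m) t {v} (iv : IsValue v) {a c} → a →vsub c → a ≡ es t (plug L v) →
  Joinable _→vsub_ (plug L ((vren (liftR (wkL L)) t) v[0≔ v ])) c
lsv-diamond L t iv (lsv L' t' iv') eq with es-injective eq
... | refl , eqA with plug-value-injective L' L iv' iv eqA
...   | refl = inj₁ refl
lsv-diamond L t iv (esL _ s) refl =
  inj₂ (_ , plug-→vsub L (vsubst-→vsub (vsingle-value iv) (vren-→vsub (liftR (wkL L)) s)) , lsv L _ iv)
lsv-diamond L t {v} iv (esR .t s) refl with plugStep L v s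
... | inside s' _ = ⊥-elim (value-normal iv (_ , s'))
... | outside L' f vf eq uniform wk =
  inj₂ (plug L' ((vren (liftR (wkL L')) t) v[0≔ vsubst f v ]) ,
        subst₂ _→vsub_ refl (cong (plug L') substituted) (uniform _) ,
        subst₂ _→vsub_ (sym (cong (es t) eq)) refl (lsv L' t (vsubst-value vf iv)))
  where
  w  = wkL L
  w' = wkL L'
  agree : (λ i → vsubst f (vsingle v (liftR w i))) ≗ (λ i → vsingle (vsubst f v) (liftR w' i))
  agree zero    = refl
  agree (suc i) = wk i
  substituted : vsubst f ((vren (liftR w) t) v[0≔ v ]) ≡ (vren (liftR w') t) v[0≔ vsubst f v ]
  substituted = begin
    vsubst f (vsubst (vsingle v) (vren (liftR w) t))   ≡⟨ cong (vsubst f) (vsubst-vren (vsingle v) (liftR w) t) ⟩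
    vsubst f (vsubst (λ i → vsingle v (liftR w i)) t)  ≡⟨ vsubst-vsubst f _ t ⟩
    vsubst (λ i → vsubst f (vsingle v (liftR w i))) t  ≡⟨ vsubst-cong agree t ⟩
    vsubst (λ i → vsingle (vsubst f v) (liftR w' i)) t ≡⟨ vsubst-vren (vsingle (vsubst f v)) (liftR w') t ⟨
    vsubst (vsingle (vsubst f v)) (vren (liftR w') t)  ∎

vsub-diamond : ∀ {n} {a b c : VTm n} → a →vsub b → a →vsub c → Joinable _→vsub_ b c
vsub-diamond (dB L t u)   s₂                = dB-diamond L t u s₂ refl
vsub-diamond (lsv L t iv) s₂                = lsv-diamond L t iv s₂ refl
vsub-diamond s₁           (dB L t u)        = Joinable-sym {R = _→vsub_} (dB-diamond L t u s₁ refl)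
vsub-diamond s₁           (lsv L t iv)      = Joinable-sym {R = _→vsub_} (lsv-diamond L t iv s₁ refl)
vsub-diamond (appR t s)   (appL u s')       = inj₂ (_ , appL _ s' , appR _ s)
vsub-diamond (appL u s)   (appR t s')       = inj₂ (_ , appR _ s' , appL _ s)
vsub-diamond (esL u s)    (esR t s')        = inj₂ (_ , esR _ s' , esL _ s)
vsub-diamond (esR t s)    (esL u s')        = inj₂ (_ , esL _ s' , esR _ s)
vsub-diamond (appR t s)   (appR .t s')      = Joinable-map (app t) (appR t) (vsub-diamond s s')
vsub-diamond (appL u s)   (appL .u s')      = Joinable-map (λ a → app a u) (appL u) (vsub-diamond s s')
vsub-diamond (esL u s)    (esL .u s')       = Joinable-map (λ a → es a u) (esL u) (vsub-diamond s s')
vsub-diamond (esR t s)    (esR .t s')       = Joinable-map (es t) (esR t) (vsub-diamond s s')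

-- Random descent

module RandomDescent {A : Set} (R : A → A → Set) (diamond : ∀ {a b c} → R a b → R a c → Joinable R b c) where

  -- Recursion on k, the length of the normalizing derivation: tiling one diamond keeps that length.
  completeTo : ∀ k {a n b} (e : Deriv R a n) → len e ≡ k → Normal R n → (e₂ : Deriv R a b) →
    Σ (Deriv R b n) λ e₃ → len e₂ + len e₃ ≡ len e
  completeTo k       e             _  nf done = e , refl
  completeTo k       done          _  nf (step s e₂) = ⊥-elim (nf (_ , s))
  completeTo (suc k) (step s₁ e₁) eq nf (step s₂ e₂) with diamond s₁ s₂
  ... | inj₁ refl with completeTo k e₁ (suc-injective eq) nf e₂
  ...   | e₃ , p = e₃ , cong suc p
  completeTo (suc k) (step s₁ e₁) eq nf (step s₂ e₂) | inj₂ (d , p , q)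
    with completeTo k e₁ (suc-injective eq) nf (step p done)
  ... | e₄ , r with completeTo k (step q e₄) (trans r (suc-injective eq)) nf e₂
  ...   | e₃ , r₂ = e₃ , cong suc (trans r₂ r)

  len-≤-normalizing : ∀ {a n b} (e : Deriv R a n) → Normal R n → (e₂ : Deriv R a b) → len e₂ ≤ len e
  len-≤-normalizing e nf e₂ with completeTo _ e refl nf e₂
  ... | e₃ , p = subst (len e₂ ≤_) p (m≤m+n (len e₂) (len e₃))

  normalizing-len-unique : ∀ {a n b} (e : Deriv R a n) → Normal R n → (e₂ : Deriv R a b) → Normal R b →
    len e₂ ≡ len e
  normalizing-len-unique e nf e₂ nf₂ with completeTo _ e refl nf e₂
  ... | done     , p = trans (sym (+-identityʳ (len e₂))) p
  ... | step s _ , p = ⊥-elim (nf₂ (_ , s))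

mutual
  inert-normal : ∀ {n} {i : Tm n} → Inert i → Normal _→βf_ i
  inert-normal (ivar x)   (_ , ())
  inert-normal (iapp () f) (_ , βλ t u)
  inert-normal (iapp () f) (_ , βi t x)
  inert-normal (iapp i f) (_ , appR _ s) = fireball-normal f (_ , s)
  inert-normal (iapp i f) (_ , appL _ s) = inert-normal i (_ , s)

  fireball-normal : ∀ {n} {f : Tm n} → Fireball f → Normal _→βf_ f
  fireball-normal (flam t)   (_ , ())
  fireball-normal (finert i) s = inert-normal i s

lam-not-inert : ∀ {n} {s : Tm (suc n)} → Inert (lam s) → ⊥
lam-not-inert ()

progress : ∀ {n} (t : Tm n) → Fireball t ⊎ ∃ (t →βf_)
progress (var x)   = inj₁ (finert (ivar x))
progress (lam t)   = inj₁ (flam t)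
progress (app t u) with progress t
... | inj₂ (t' , s) = inj₂ (_ , appL u s)
... | inj₁ ft with progress u
...   | inj₂ (u' , s) = inj₂ (_ , appR t s)
...   | inj₁ fu = fireballs-app ft fu
  where
  fireballs-app : ∀ {n} {t u : Tm n} → Fireball t → Fireball u → Fireball (app t u) ⊎ ∃ (app t u →βf_)
  fireballs-app (flam t')  (flam u')   = inj₂ (_ , βλ t' u')
  fireballs-app (flam t')  (finert i)  = inj₂ (_ , βi t' i)
  fireballs-app (finert i) fu          = inj₁ (finert (iapp i fu))

InertEnv : ∀ {n k} → (Fin n → Tm k) → Set
InertEnv σ = ∀ i → Inert (σ i)

extend-inert : ∀ {n k} {σ : Fin n → Tm k} {u} → InertEnv σ → Inert u → InertEnv (extend σ u)
extend-inert iσ iu zero    = iu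
extend-inert iσ iu (suc i) = iσ i

-- L⟨t u⟩: exactly the terms that are not answers L⟨v⟩.
data NotAnswer : ∀ {n} → VTm n → Set where
  app : ∀ {n} (a b : VTm n) → NotAnswer (app a b)
  es  : ∀ {n} {s : VTm (suc n)} (c : VTm n) → NotAnswer s → NotAnswer (es s c)

-- The invariant of vsub-terms reached from λ-terms: abstraction bodies are untouched λ-terms and
-- every explicit substitution holds an inert term that is not an answer (else lsv would fire it).
-- ProperInert and ProperFireball are the proper terms that unfold to inert terms and fireballs.
mutual
  data ProperInert : ∀ {n} → VTm n → Set where
    var : ∀ {n} (x : Fin n) → ProperInert (var x)
    app : ∀ {n} {a b : VTm n} → ProperInert a → ProperFireball b → ProperInert (app a b)
    es  : ∀ {n} {s : VTm (suc n)} {c : VTm n} → ProperInert s → ProperInert c → NotAnswer c → ProperInert (es s c)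

  data ProperFireball : ∀ {n} → VTm n → Set where
    inert : ∀ {n} {a : VTm n} → ProperInert a → ProperFireball a
    lam   : ∀ {n} (t : Tm (suc n)) → ProperFireball (lam (ι t))
    es    : ∀ {n} {s : VTm (suc n)} {c : VTm n} → ProperFireball s → ProperInert c → NotAnswer c → ProperFireball (es s c)

data Proper : ∀ {n} → VTm n → Set where
  var : ∀ {n} (x : Fin n) → Proper (var x)
  lam : ∀ {n} (t : Tm (suc n)) → Proper (lam (ι t))
  app : ∀ {n} {a b : VTm n} → Proper a → Proper b → Proper (app a b)
  es  : ∀ {n} {s : VTm (suc n)} {c : VTm n} → Proper s → ProperInert c → NotAnswer c → Proper (es s c)

mutual
  ProperInert⇒Proper : ∀ {n} {a : VTm n} → ProperInert a → Proper a
  ProperInert⇒Proper (var x)      = var x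
  ProperInert⇒Proper (app a b)    = app (ProperInert⇒Proper a) (ProperFireball⇒Proper b)
  ProperInert⇒Proper (es s c nac) = es (ProperInert⇒Proper s) c nac

  ProperFireball⇒Proper : ∀ {n} {a : VTm n} → ProperFireball a → Proper a
  ProperFireball⇒Proper (inert a)    = ProperInert⇒Proper a
  ProperFireball⇒Proper (lam t)      = lam t
  ProperFireball⇒Proper (es s c nac) = es (ProperFireball⇒Proper s) c nac

NotAnswer-vren : ∀ {n m} (ρ : Fin n → Fin m) {a} → NotAnswer a → NotAnswer (vren ρ a)
NotAnswer-vren ρ (app a b)  = app _ _
NotAnswer-vren ρ (es c nas) = es _ (NotAnswer-vren (liftR ρ) nas)

vren-lam-ι : ∀ {n m} (ρ : Fin n → Fin m) t → vren ρ (lam (ι t)) ≡ lam (ι (ren (liftR ρ) t))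
vren-lam-ι ρ t = cong lam (vren-ι (liftR ρ) t)

mutual
  ProperInert-vren : ∀ {n m} (ρ : Fin n → Fin m) {a} → ProperInert a → ProperInert (vren ρ a)
  ProperInert-vren ρ (var x)      = var _
  ProperInert-vren ρ (app a b)    = app (ProperInert-vren ρ a) (ProperFireball-vren ρ b)
  ProperInert-vren ρ (es s c nac) = es (ProperInert-vren (liftR ρ) s) (ProperInert-vren ρ c) (NotAnswer-vren ρ nac)

  ProperFireball-vren : ∀ {n m} (ρ : Fin n → Fin m) {a} → ProperFireball a → ProperFireball (vren ρ a)
  ProperFireball-vren ρ (inert a)    = inert (ProperInert-vren ρ a)
  ProperFireball-vren ρ (lam t)      = subst ProperFireball (sym (vren-lam-ι ρ t)) (lam _)
  ProperFireball-vren ρ (es s c nac) = es (ProperFireball-vren (liftR ρ) s) (ProperInert-vren ρ c) (NotAnswer-vren ρ nac)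

Proper-vren : ∀ {n m} (ρ : Fin n → Fin m) {a} → Proper a → Proper (vren ρ a)
Proper-vren ρ (var x)      = var _
Proper-vren ρ (lam t)      = subst Proper (sym (vren-lam-ι ρ t)) (lam _)
Proper-vren ρ (app a b)    = app (Proper-vren ρ a) (Proper-vren ρ b)
Proper-vren ρ (es s c nac) = es (Proper-vren (liftR ρ) s) (ProperInert-vren ρ c) (NotAnswer-vren ρ nac)

Proper-ι : ∀ {n} (t : Tm n) → Proper (ι t)
Proper-ι (var x)   = var x
Proper-ι (lam t)   = lam t
Proper-ι (app t u) = app (Proper-ι t) (Proper-ι u)

mutual
  unfold-inert : ∀ {n k} {σ : Fin n → Tm k} {a} → ProperInert a → InertEnv σ → Inert (unfold σ a)
  unfold-inert (var x)     iσ = iσ x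
  unfold-inert (app a b)   iσ = iapp (unfold-inert a iσ) (unfold-fireball b iσ)
  unfold-inert (es s c _)  iσ = unfold-inert s (extend-inert iσ (unfold-inert c iσ))

  unfold-fireball : ∀ {n k} {σ : Fin n → Tm k} {a} → ProperFireball a → InertEnv σ → Fireball (unfold σ a)
  unfold-fireball (inert a)   iσ = finert (unfold-inert a iσ)
  unfold-fireball (lam t)     iσ = flam _
  unfold-fireball (es s c _)  iσ = unfold-fireball s (extend-inert iσ (unfold-inert c iσ))

mutual
  inert⇒ProperInert : ∀ {n k} {σ : Fin n → Tm k} {a} → Proper a → InertEnv σ → Inert (unfold σ a) → ProperInert a
  inert⇒ProperInert (var x)        iσ _          = var x
  inert⇒ProperInert (lam t)        iσ ()
  inert⇒ProperInert (app pa pb)    iσ (iapp i f) = app (inert⇒ProperInert pa iσ i) (fireball⇒ProperFireball pb iσ f)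
  inert⇒ProperInert (es ps pc nac) iσ i          = es (inert⇒ProperInert ps (extend-inert iσ (unfold-inert pc iσ)) i) pc nac

  fireball⇒ProperFireball : ∀ {n k} {σ : Fin n → Tm k} {a} → Proper a → InertEnv σ → Fireball (unfold σ a) → ProperFireball a
  fireball⇒ProperFireball (var x)        iσ _          = inert (var x)
  fireball⇒ProperFireball (lam t)        iσ _          = lam t
  fireball⇒ProperFireball (app pa pb)    iσ (finert i) = inert (inert⇒ProperInert (app pa pb) iσ i)
  fireball⇒ProperFireball (es ps pc nac) iσ f          = es (fireball⇒ProperFireball ps (extend-inert iσ (unfold-inert pc iσ)) f) pc nac

NotAnswer-fireball⇒inert : ∀ {n k} {σ : Fin n → Tm k} {a} → NotAnswer a → Fireball (unfold σ a) → Inert (unfold σ a)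
NotAnswer-fireball⇒inert (app a b)  (finert i) = i
NotAnswer-fireball⇒inert (es c nas) f          = NotAnswer-fireball⇒inert nas f

plug-value-answer : ∀ {n m} (L : SCtx n m) {v} → IsValue v → NotAnswer (plug L v) → ⊥
plug-value-answer hole       (vvar x) ()
plug-value-answer hole       (vlam t) ()
plug-value-answer (esub L u) iv       (es _ nas) = plug-value-answer L iv nas

data ProperCtx : ∀ {n m} → SCtx n m → Set where
  hole : ∀ {n} → ProperCtx (hole {n})
  esub : ∀ {n m} {L : SCtx (suc n) m} {u : VTm n} → ProperCtx L → ProperInert u → NotAnswer u → ProperCtx (esub L u)

Proper-plug : ∀ {n m} {L : SCtx n m} {t} → ProperCtx L → Proper t → Proper (plug L t)
Proper-plug hole              pt = pt
Proper-plug (esub pL pu nau)  pt = es (Proper-plug pL pt) pu nau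

unfoldCtx-inert : ∀ {n m k} {L : SCtx n m} {σ : Fin n → Tm k} → ProperCtx L → InertEnv σ → InertEnv (unfoldCtx σ L)
unfoldCtx-inert hole             iσ = iσ
unfoldCtx-inert (esub pL pu _)   iσ = unfoldCtx-inert pL (extend-inert iσ (unfold-inert pu iσ))

data PureValue : ∀ {m} → VTm m → Set where
  var : ∀ {m} (x : Fin m) → PureValue (ι (var x))
  lam : ∀ {m} (t : Tm (suc m)) → PureValue (ι (lam t))

pureValue-tm : ∀ {m} {v : VTm m} → PureValue v → Tm m
pureValue-tm (var x) = var x
pureValue-tm (lam t) = lam t

pureValue-ι : ∀ {m} {v : VTm m} (pv : PureValue v) → v ≡ ι (pureValue-tm pv)
pureValue-ι (var x) = refl
pureValue-ι (lam t) = refl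

PureValue⇒IsValue : ∀ {m} {v : VTm m} → PureValue v → IsValue v
PureValue⇒IsValue (var x) = vvar x
PureValue⇒IsValue (lam t) = vlam _

data AnswerView {n} : VTm n → Set where
  notAnswer : ∀ {a} → NotAnswer a → AnswerView a
  answer    : ∀ {m} (L : SCtx n m) {v} → PureValue v → ProperCtx L → AnswerView (plug L v)

answerView : ∀ {n} {a : VTm n} → Proper a → AnswerView a
answerView (var x)      = answer hole (var x) hole
answerView (lam t)      = answer hole (lam t) hole
answerView (app pa pb)  = notAnswer (app _ _)
answerView (es ps pc nac) with answerView ps
... | notAnswer nas   = notAnswer (es _ nas)
... | answer L pv pL  = answer (esub L _) pv (esub pL pc nac)

-- Simulation of βf by vsub, through unfolding

ι-[0≔] : ∀ {n} (t : Tm (suc n)) u → (ι t) v[0≔ ι u ] ≡ ι (t [0≔ u ])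
ι-[0≔] t u = trans (vsubst-cong vsingle-ι (ι t)) (vsubst-ι (single u) t)
  where
  vsingle-ι : vsingle (ι u) ≗ (λ i → ι (single u i))
  vsingle-ι zero    = refl
  vsingle-ι (suc i) = refl

unfold-liftS-[0≔] : ∀ {n k} (τ : Fin n → Tm k) t u → (unfold (liftS τ) t) [0≔ u ] ≡ unfold (extend τ u) t
unfold-liftS-[0≔] τ t u = trans (sub-unfold (single u) (liftS τ) t) (unfold-cong single-liftS t)
  where
  single-liftS : (λ i → sub (single u) (liftS τ i)) ≗ extend τ u
  single-liftS zero    = refl
  single-liftS (suc i) = trans (sub-ren _ suc (τ i)) (sub-var (τ i))

unfold-vren-wkL : ∀ {n m k} (σ : Fin n → Tm k) (L : SCtx n m) u → unfold (unfoldCtx σ L) (vren (wkL L) u) ≡ unfold σ u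
unfold-vren-wkL σ L u = trans (unfold-vren (unfoldCtx σ L) (wkL L) u) (unfold-cong (unfoldCtx-wkL σ L) u)

unfold-dB : ∀ {n m k} (σ : Fin n → Tm k) (L : SCtx n m) t u →
  unfold σ (plug L (es t (vren (wkL L) u))) ≡ unfold (extend (unfoldCtx σ L) (unfold σ u)) t
unfold-dB σ L t u =
  trans (unfold-plug σ L _) (unfold-cong (extend-cong (λ _ → refl) (unfold-vren-wkL σ L u)) t)

unfold-lsv : ∀ {n m k} (σ : Fin n → Tm k) (L : SCtx n m) t v →
  unfold σ (plug L ((vren (liftR (wkL L)) t) v[0≔ v ])) ≡ unfold σ (es t (plug L v))
unfold-lsv σ L t v = begin
  unfold σ (plug L ((vren (liftR (wkL L)) t) v[0≔ v ]))         ≡⟨ unfold-plug σ L _ ⟩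
  unfold τ (vsubst (vsingle v) (vren (liftR (wkL L)) t))        ≡⟨ unfold-vsubst τ (vsingle v) (vren (liftR (wkL L)) t) ⟩
  unfold (λ i → unfold τ (vsingle v i)) (vren (liftR (wkL L)) t) ≡⟨ unfold-vren _ (liftR (wkL L)) t ⟩
  unfold (λ i → unfold τ (vsingle v (liftR (wkL L) i))) t       ≡⟨ unfold-cong agree t ⟩
  unfold (extend σ (unfold σ (plug L v))) t                     ∎
  where
  τ = unfoldCtx σ L
  agree : (λ i → unfold τ (vsingle v (liftR (wkL L) i))) ≗ extend σ (unfold σ (plug L v))
  agree zero    = sym (unfold-plug σ L v)
  agree (suc i) = unfoldCtx-wkL σ L i

vsub-step⇒βf-step : ∀ {n k} {σ : Fin n → Tm k} {a b} → Proper a → InertEnv σ → a →vsub b → ∃ (unfold σ a →βf_)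
vsub-step⇒βf-step {σ = σ} (app pa pb) iσ (dB L t u) =
  subst (λ f → ∃ (app f (unfold σ u) →βf_)) (sym (unfold-plug σ L (lam t))) (redex (progress (unfold σ u)))
  where
  redex : ∀ {k} {s : Tm (suc k)} {u : Tm k} → Fireball u ⊎ ∃ (u →βf_) → ∃ (app (lam s) u →βf_)
  redex (inj₁ (flam u))   = _ , βλ _ u
  redex (inj₁ (finert i)) = _ , βi _ i
  redex (inj₂ (_ , s))    = _ , appR _ s
vsub-step⇒βf-step (es ps pc nac) iσ (lsv L t iv) = ⊥-elim (plug-value-answer L iv nac)
vsub-step⇒βf-step (app pa pb)    iσ (appL u s) with vsub-step⇒βf-step pa iσ s
... | _ , s' = _ , appL _ s'
vsub-step⇒βf-step (app pa pb)    iσ (appR t s) with vsub-step⇒βf-step pb iσ s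
... | _ , s' = _ , appR _ s'
vsub-step⇒βf-step (es ps pc nac) iσ (esL u s) = vsub-step⇒βf-step ps (extend-inert iσ (unfold-inert pc iσ)) s
vsub-step⇒βf-step (es ps pc nac) iσ (esR t s) =
  ⊥-elim (inert-normal (unfold-inert pc iσ) (vsub-step⇒βf-step (ProperInert⇒Proper pc) iσ s))

data OneOrTwo {n} (a b : VTm n) : Set where
  one : a →vsub b → OneOrTwo a b
  two : ∀ {c} → a →vsub c → c →vsub b → OneOrTwo a b

OneOrTwo-map : ∀ {n m} (F : VTm n → VTm m) → (∀ {a b} → a →vsub b → F a →vsub F b) →
  ∀ {a b} → OneOrTwo a b → OneOrTwo (F a) (F b)
OneOrTwo-map F F-step (one s)    = one (F-step s)
OneOrTwo-map F F-step (two s s') = two (F-step s) (F-step s')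

Simulated : ∀ {n k} → (Fin n → Tm k) → VTm n → Tm k → Set
Simulated {n} σ a t = Σ (VTm n) λ a' → OneOrTwo a a' × Proper a' × unfold σ a' ≡ t

-- After a dB step the argument b is either inert and not an answer, so the new substitution is
-- proper, or an answer L₂⟨v⟩, which one lsv step substitutes without changing the unfolding.
fire-argument : ∀ {n m k} {σ : Fin n → Tm k} (L : SCtx n m) (t : Tm (suc m)) {a : VTm n} {b : VTm m} →
  ProperCtx L → Proper b → InertEnv σ → Fireball (unfold (unfoldCtx σ L) b) →
  a →vsub plug L (es (ι t) b) → Simulated σ a (unfold σ (plug L (es (ι t) b)))
fire-argument {σ = σ} L t {b = b} pL pb iσ fb s with answerView pb
... | notAnswer nab =
  plug L (es (ι t) b) , one s , Proper-plug pL (es (Proper-ι t) pib nab) , refl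
  where
  pib : ProperInert b
  pib = inert⇒ProperInert pb (unfoldCtx-inert pL iσ) (NotAnswer-fireball⇒inert nab fb)
... | answer L₂ {v} pv pL₂ =
  plug L (plug L₂ fired) , two s (plug-→vsub L (lsv L₂ (ι t) (PureValue⇒IsValue pv))) ,
  Proper-plug pL (Proper-plug pL₂ (subst Proper (sym fired-ι) (Proper-ι _))) , same-unfolding
  where
  τ = unfoldCtx σ L
  ρ = liftR (wkL L₂)
  fired = (vren ρ (ι t)) v[0≔ v ]
  fired-ι : fired ≡ ι ((ren ρ t) [0≔ pureValue-tm pv ])
  fired-ι = begin
    (vren ρ (ι t)) v[0≔ v ]                    ≡⟨ cong₂ _v[0≔_] (vren-ι ρ t) (pureValue-ι pv) ⟩
    (ι (ren ρ t)) v[0≔ ι (pureValue-tm pv) ]   ≡⟨ ι-[0≔] (ren ρ t) (pureValue-tm pv) ⟩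
    ι ((ren ρ t) [0≔ pureValue-tm pv ])        ∎
  same-unfolding : unfold σ (plug L (plug L₂ fired)) ≡ unfold σ (plug L (es (ι t) (plug L₂ v)))
  same-unfolding = begin
    unfold σ (plug L (plug L₂ fired))          ≡⟨ unfold-plug σ L _ ⟩
    unfold τ (plug L₂ fired)                   ≡⟨ unfold-lsv τ L₂ (ι t) v ⟩
    unfold τ (es (ι t) (plug L₂ v))            ≡⟨ unfold-plug σ L _ ⟨
    unfold σ (plug L (es (ι t) (plug L₂ v)))   ∎

simulate-root : ∀ {n k} {σ : Fin n → Tm k} {a b : VTm n} {s u} → Proper a → Proper b → InertEnv σ →
  lam s ≡ unfold σ a → u ≡ unfold σ b → Fireball u → Simulated σ (app a b) (s [0≔ u ])
simulate-root {σ = σ} pa pb iσ eqA eqB fu with answerView pa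
... | notAnswer naa =
  ⊥-elim (lam-not-inert (subst Inert (sym eqA) (NotAnswer-fireball⇒inert naa (subst Fireball eqA (flam _)))))
... | answer L (var x) pL =
  ⊥-elim (lam-not-inert (subst Inert (sym (trans eqA (unfold-plug σ L (var x)))) (unfoldCtx-inert pL iσ x)))
simulate-root {σ = σ} {b = b} {s} {u} pa pb iσ eqA refl fu | answer L (lam t) pL =
  subst (Simulated σ (app (plug L (lam (ι t))) b)) target
    (fire-argument L t pL (Proper-vren (wkL L) pb) iσ
      (subst Fireball (sym (unfold-vren-wkL σ L b)) fu) (dB L (ι t) b))
  where
  τ = unfoldCtx σ L
  body : s ≡ unfold (liftS τ) (ι t)
  body = cong (λ { (lam r) → r ; _ → s }) (trans eqA (unfold-plug σ L _))
  target : unfold σ (plug L (es (ι t) (vren (wkL L) b))) ≡ s [0≔ u ]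
  target = begin
    unfold σ (plug L (es (ι t) (vren (wkL L) b)))  ≡⟨ unfold-dB σ L (ι t) b ⟩
    unfold (extend τ u) (ι t)                      ≡⟨ unfold-liftS-[0≔] τ (ι t) u ⟨
    (unfold (liftS τ) (ι t)) [0≔ u ]               ≡⟨ cong _[0≔ u ] body ⟨
    s [0≔ u ]                                      ∎

mutual
  simulate-step : ∀ {n k} {σ : Fin n → Tm k} {a t} → Proper a → InertEnv σ → unfold σ a →βf t → Simulated σ a t
  simulate-step (var x)        iσ s = ⊥-elim (inert-normal (iσ x) (_ , s))
  simulate-step (lam t)        iσ ()
  simulate-step (es ps pc nac) iσ s with simulate-step ps (extend-inert iσ (unfold-inert pc iσ)) s
  ... | a' , ss , pa' , eq = es a' _ , OneOrTwo-map (λ x → es x _) (esL _) ss , es pa' pc nac , eq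
  simulate-step (app pa pb)    iσ s = simulate-app-step pa pb iσ refl refl s

  simulate-app-step : ∀ {n k} {σ : Fin n → Tm k} {a b : VTm n} {f u t} → Proper a → Proper b → InertEnv σ →
    f ≡ unfold σ a → u ≡ unfold σ b → app f u →βf t → Simulated σ (app a b) t
  simulate-app-step pa pb iσ eqA eqB (βλ s u)   = simulate-root pa pb iσ eqA eqB (flam u)
  simulate-app-step pa pb iσ eqA eqB (βi s i)   = simulate-root pa pb iσ eqA eqB (finert i)
  simulate-app-step {b = b} pa pb iσ refl refl (appL _ s) with simulate-step pa iσ s
  ... | a' , ss , pa' , eq = app a' b , OneOrTwo-map (λ x → app x b) (appL b) ss , app pa' pb , cong₂ app eq refl
  simulate-app-step {a = a} pa pb iσ refl refl (appR _ s) with simulate-step pb iσ s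
  ... | b' , ss , pb' , eq = app a b' , OneOrTwo-map (app a) (appR a) ss , app pa pb' , cong₂ app refl eq

Normalizing : ∀ {A : Set} → (A → A → Set) → A → Set
Normalizing R a = ∃ λ b → Σ (Deriv R a b) λ _ → Normal R b

var-inert : ∀ {n} → InertEnv (var {n})
var-inert = ivar

prepend : ∀ {n} {a b c : VTm n} → OneOrTwo a b → Deriv _→vsub_ b c → Deriv _→vsub_ a c
prepend (one s)    e = step s e
prepend (two s s') e = step s (step s' e)

1+len≤len-prepend : ∀ {n} {a b c : VTm n} (ss : OneOrTwo a b) (e : Deriv _→vsub_ b c) → suc (len e) ≤ len (prepend ss e)
1+len≤len-prepend (one s)    e = ≤-refl
1+len≤len-prepend (two s s') e = n≤1+n _

len-prepend≤2+len : ∀ {n} {a b c : VTm n} (ss : OneOrTwo a b) (e : Deriv _→vsub_ b c) → len (prepend ss e) ≤ suc (suc (len e))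
len-prepend≤2+len (one s)    e = n≤1+n _
len-prepend≤2+len (two s s') e = ≤-refl

simulate : ∀ {n} {s s' : Tm n} (d : Deriv _→βf_ s s') {a} → Proper a → s ≡ unfold var a →
  Σ (VTm n) λ a' → Σ (Deriv _→vsub_ a a') λ e →
    len d ≤ len e × len e ≤ len d + len d × s' ≡ unfold var a' × Proper a'
simulate done         {a} pa eq = a , done , z≤n , z≤n , eq , pa
simulate (step st d) pa refl with simulate-step pa var-inert st
... | a₁ , ss , pa₁ , eq₁ with simulate d pa₁ (sym eq₁)
...   | a' , e , lower , upper , eq' , pa' =
  a' , prepend ss e ,
  ≤-trans (s≤s lower) (1+len≤len-prepend ss e) ,
  ≤-trans (len-prepend≤2+len ss e) (s≤s (≤-trans (s≤s upper) (≤-reflexive (sym (+-suc (len d) (len d)))))) ,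
  eq' , pa'

normal-reflected : ∀ {n} {s : Tm n} {a} → Proper a → s ≡ unfold var a → Normal _→βf_ s → Normal _→vsub_ a
normal-reflected pa refl nf (_ , st) = nf (vsub-step⇒βf-step pa var-inert st)

-- Each βf-step costs at least one vsub-step, so a bound on all vsub-derivations bounds the βf-evaluation.
βf-normalizes : ∀ j {n} {s : Tm n} {a} → Proper a → s ≡ unfold var a →
  (∀ {b} (e : Deriv _→vsub_ a b) → len e ≤ j) → Normalizing _→βf_ s
βf-normalizes j {s = s} pa eq bound with progress s
... | inj₁ fs = s , done , fireball-normal fs
... | inj₂ (s₁ , st) with simulate-step pa var-inert (subst (_→βf s₁) eq st)
...   | a₁ , ss , pa₁ , eq₁ = continue j bound₁
  where
  bound₁ : ∀ {b} (e : Deriv _→vsub_ a₁ b) → suc (len e) ≤ j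
  bound₁ e = ≤-trans (1+len≤len-prepend ss e) (bound (prepend ss e))
  continue : ∀ k → (∀ {b} (e : Deriv _→vsub_ a₁ b) → suc (len e) ≤ k) → Normalizing _→βf_ s
  continue zero    bound′ with bound′ done
  ... | ()
  continue (suc k) bound′ with βf-normalizes k pa₁ (sym eq₁) (λ e → ≤-pred (bound′ e))
  ... | s' , d , nf = s' , step st d , nf

corollary1 : ∀ {n : ℕ} (t : Tm n) →
    ((∃ λ s → Σ (Deriv _→βf_ t s) λ d → Normal _→βf_ s)
      ⇔ (∃ λ s → Σ (Deriv _→vsub_ (ι t) s) λ e → Normal _→vsub_ s))
    × (∀ {s : Tm n} {s' : VTm n} (d : Deriv _→βf_ t s) (e : Deriv _→vsub_ (ι t) s') →
         Normal _→βf_ s → Normal _→vsub_ s' →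
         (len d ≤ len e) × (len e ≤ 2 * len d))
corollary1 t = mk⇔ βf⇒vsub vsub⇒βf , bounds
  where
  open RandomDescent _→vsub_ vsub-diamond
  t-unfolds : t ≡ unfold var (ι t)
  t-unfolds = sym (trans (unfold-ι var t) (sub-var t))
  βf⇒vsub : Normalizing _→βf_ t → Normalizing _→vsub_ (ι t)
  βf⇒vsub (s , d , nf) with simulate d (Proper-ι t) t-unfolds
  ... | a , e , _ , _ , eq , pa = a , e , normal-reflected pa eq nf
  vsub⇒βf : Normalizing _→vsub_ (ι t) → Normalizing _→βf_ t
  vsub⇒βf (_ , e , nf) = βf-normalizes (len e) (Proper-ι t) t-unfolds (len-≤-normalizing e nf)
  bounds : ∀ {s s'} (d : Deriv _→βf_ t s) (e : Deriv _→vsub_ (ι t) s') → Normal _→βf_ s → Normal _→vsub_ s' →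
    len d ≤ len e × len e ≤ 2 * len d
  bounds d e nf nf' with simulate d (Proper-ι t) t-unfolds
  ... | a , e' , lower , upper , eq , pa
    rewrite normalizing-len-unique e' (normal-reflected pa eq nf) e nf'
          | +-identityʳ (len d) = lower , upper
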